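{- Let $D\subseteq K^n$ be a Kleinian code. The equivalence classes of markings of $D$ are in one-to-one correspondence with the equivalence classes of $L$-codes $C\subseteq L^n$ such that $\phi(C)$ is equivalent (as a Kleinian code) to $D$.
   Context: Let $L=\{0,1,\omega,\bar\omega\}$ and $K=\{0,a,b,c\}$ both denote the Klein four-group $\mathbf{Z}_2\times\mathbf{Z}_2$. An $L$-code of length $n$ is a subgroup of $L^n$; a Kleinian code of length $n$ is a subgroup of $K^n$. The group $G=S_2^n{:}S_n$ acts on $L^n$ by permuting coordinates and independently interchanging $\omega,\bar\omega$ in each coordinate; $H=S_3^n{:}S_n$ acts on $K^n$ by permuting coordinates and independently permuting $a,b,c$ in each coordinate. Two $L$-codes (resp. Kleinian codes) are equivalent if they lie in the same $G$-orbit (resp. $H$-orbit); $\mathrm{Aut}(D)=\{h\in H:hD=D\}$. The map $\phi:L^n\to K^n$ is applied coordinatewise by $0\mapsto0$, $1\mapsto a$, $\omega\mapsto b$, $\bar\omega\mapsto c$. A marking of $D$ is a vector $\mathcal{M}\in(K\setminus\{0\})^n$; two markings $\mathcal{M}_1,\mathcal{M}_2$ of $D$ are equivalent if $g\mathcal{M}_1=\mathcal{M}_2$ for some $g\in\mathrm{Aut}(D)$. -}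

module Defs where

open import Data.Nat using (ℕ)
open import Data.Bool using (Bool; true; false)
open import Data.Fin using (Fin; zero; suc)
open import Data.Fin.Permutation using (Permutation′; _⟨$⟩ʳ_; _⟨$⟩ˡ_)
open import Data.Vec using (Vec; lookup; tabulate; map; zipWith; replicate)
open import Data.Vec.Relation.Unary.All using (All)
open import Data.Product using (Σ; _×_; _,_; ∃)
open import Relation.Binary.PropositionalEquality using (_≡_; _≢_)
open import Function.Bundles using (_⇔_)
open import Level using (0ℓ)
open import Relation.Unary using (Pred)

data L : Set where
  0L 1L ωL ω̄L : L

data K : Set where
  0K aK bK cK : K

-- group law of L ≅ Z₂ × Z₂ (every non-zero element has order 2,
-- the sum of two distinct non-zero elements is the third one)
_+L_ : L → L → L
0L  +L y   = y
x   +L 0L  = x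
1L  +L 1L  = 0L
1L  +L ωL  = ω̄L
1L  +L ω̄L = ωL
ωL  +L 1L  = ω̄L
ωL  +L ωL  = 0L
ωL  +L ω̄L = 1L
ω̄L +L 1L  = ωL
ω̄L +L ωL  = 1L
ω̄L +L ω̄L = 0L

_+K_ : K → K → K
0K +K y  = y
x  +K 0K = x
aK +K aK = 0K
aK +K bK = cK
aK +K cK = bK
bK +K aK = cK
bK +K bK = 0K
bK +K cK = aK
cK +K aK = bK
cK +K bK = aK
cK +K cK = 0K

-- Codes: subgroups of L^n resp. K^n, given as subsets (predicates).

IsLCode : ∀ {n} → Pred (Vec L n) 0ℓ → Set
IsLCode {n} C = C (replicate n 0L) × (∀ x y → C x → C y → C (zipWith _+L_ x y))

IsKleinianCode : ∀ {n} → Pred (Vec K n) 0ℓ → Set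
IsKleinianCode {n} D = D (replicate n 0K) × (∀ x y → D x → D y → D (zipWith _+K_ x y))

record LCode (n : ℕ) : Set₁ where
  field
    code   : Pred (Vec L n) 0ℓ
    isCode : IsLCode code
open LCode public

φ : L → K
φ 0L  = 0K
φ 1L  = aK
φ ωL  = bK
φ ω̄L = cK

φ-image : ∀ {n} → Pred (Vec L n) 0ℓ → Pred (Vec K n) 0ℓ
φ-image C y = ∃ λ x → C x × map φ x ≡ y

-- The group G = S₂^n : S_n acting on L^n.
-- An element: a coordinate permutation σ and for each coordinate a flag
-- saying whether ω, ω̄ are interchanged there.

swapω : Bool → L → L
swapω false x   = x
swapω true  0L  = 0L
swapω true  1L  = 1L
swapω true  ωL  = ω̄L
swapω true  ω̄L = ωL

record GElt (n : ℕ) : Set where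
  constructor mkG
  field
    perm  : Permutation′ n
    flips : Fin n → Bool

-- (g x)_{σ i} = τ_i (x_i)
actG : ∀ {n} → GElt n → Vec L n → Vec L n
actG (mkG σ τ) x = tabulate λ j → swapω (τ (σ ⟨$⟩ˡ j)) (lookup x (σ ⟨$⟩ˡ j))

-- The group H = S₃^n : S_n acting on K^n.
-- S₃ acts on {a,b,c} (encoded as Fin 3), fixing 0.

permABC : Permutation′ 3 → K → K
permABC π 0K = 0K
permABC π aK = decode (π ⟨$⟩ʳ zero)
  where
  decode : Fin 3 → K
  decode zero = aK
  decode (suc zero) = bK
  decode (suc (suc zero)) = cK
permABC π bK = decode (π ⟨$⟩ʳ suc zero)
  where
  decode : Fin 3 → K
  decode zero = aK
  decode (suc zero) = bK
  decode (suc (suc zero)) = cK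
permABC π cK = decode (π ⟨$⟩ʳ suc (suc zero))
  where
  decode : Fin 3 → K
  decode zero = aK
  decode (suc zero) = bK
  decode (suc (suc zero)) = cK

record HElt (n : ℕ) : Set where
  constructor mkH
  field
    perm  : Permutation′ n
    perms : Fin n → Permutation′ 3

actH : ∀ {n} → HElt n → Vec K n → Vec K n
actH (mkH σ τ) x = tabulate λ j → permABC (τ (σ ⟨$⟩ˡ j)) (lookup x (σ ⟨$⟩ˡ j))

_≈G_ : ∀ {n} → Pred (Vec L n) 0ℓ → Pred (Vec L n) 0ℓ → Set
_≈G_ {n} C₁ C₂ = Σ (GElt n) λ g → ∀ x → C₁ x ⇔ C₂ (actG g x)

_≈H_ : ∀ {n} → Pred (Vec K n) 0ℓ → Pred (Vec K n) 0ℓ → Set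
_≈H_ {n} D₁ D₂ = Σ (HElt n) λ h → ∀ x → D₁ x ⇔ D₂ (actH h x)

InAut : ∀ {n} → Pred (Vec K n) 0ℓ → HElt n → Set
InAut D h = ∀ x → D x ⇔ D (actH h x)

Marking : ℕ → Set
Marking n = Σ (Vec K n) (All (_≢ 0K))

MarkingEquiv : ∀ {n} → Pred (Vec K n) 0ℓ → Marking n → Marking n → Set
MarkingEquiv {n} D (M₁ , _) (M₂ , _) = Σ (HElt n) λ g → InAut D g × actH g M₁ ≡ M₂

-- A non-zero m ∈ K determines a group isomorphism ψ m : L → K with
-- ψ m 1 = m, namely φ followed by the rotation of {a,b,c} taking a to m.
-- A marking M then gives the L-code C_M = { x : Ψ M x ∈ D }, where Ψ M
-- applies ψ (M i) in coordinate i.  Everything rests on two transport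
-- facts relating the groups G and H through Ψ:
--   * H-to-G: for h ∈ H and a marking M there is g ∈ G with
--     Ψ (h M) ∘ g = h ∘ Ψ M (an element of S₃ conjugates ψ m into
--     ψ (s m), up to the interchange ω ↔ ω̄ when s is odd);
--   * G-to-H: for g ∈ G and any M₁, M₂ there is h ∈ H with
--     Ψ M₂ ∘ g = h ∘ Ψ M₁.
-- All facts about single coordinates are identities between maps of the
-- four-element sets L and K and of S₃; they are verified by exhaustive
-- evaluation.  The correspondence M ↦ C_M then follows: φ(C_M) ≈ D by
-- G-to-H, equivalent markings give equivalent codes by H-to-G, the
-- converse by G-to-H, and every admissible C is C_M for M = h(a,…,a).
module Submission where

open import Defs
open import Data.Nat using (ℕ)
open import Data.Vec using (Vec; lookup; map; zipWith; replicate)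
open import Data.Product using (Σ; _×_; ∃; _,_; proj₁; proj₂)
open import Function.Bundles using (_⇔_)
open import Level using (0ℓ)
open import Relation.Unary using (Pred; Decidable)
open import Data.Bool using (Bool; true; false)
open import Data.Fin using (Fin; zero; suc)
import Data.Fin.Properties as Fin
open import Data.Fin.Permutation
  using (Permutation′; _⟨$⟩ʳ_; _⟨$⟩ˡ_; permutation; inverseˡ; inverseʳ; flip)
  renaming (id to idₚ)
open import Data.Vec.Properties
  using (lookup∘tabulate; lookup-zipWith; lookup-replicate; lookup-map)
open import Data.Vec.Relation.Binary.Pointwise.Extensional using (ext; Pointwise-≡⇒≡)
open import Data.Vec.Relation.Unary.All using (All)
open import Data.Vec.Relation.Unary.All.Properties using (lookup⁺; lookup⁻)
open import Function using (_∘_)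
open import Function.Bundles using (mk⇔)
open import Function.Properties.Equivalence using (⇔-setoid)
open import Relation.Binary.Definitions using (DecidableEquality)
open import Relation.Binary.PropositionalEquality
  using (_≡_; _≢_; refl; sym; trans; cong; cong₂; subst; module ≡-Reasoning)
import Relation.Binary.Reasoning.Setoid as SetoidReasoning
open import Relation.Nullary using (Dec; ¬?; _×-dec_; _→-dec_)
open import Relation.Nullary.Decidable using (map′; from-yes)

module ⇔-Reasoning = SetoidReasoning (⇔-setoid 0ℓ)

-- Finite types: statements quantified over them are decided by evaluation.

record Finite (A : Set) : Set where
  field
    size          : ℕ
    index         : A → Fin size
    element       : Fin size → A
    element-index : ∀ x → element (index x) ≡ x

open Finite {{...}}

module _ {A : Set} {{_ : Finite A}} where

  ∀? : {P : A → Set} → Decidable P → Dec (∀ x → P x)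
  ∀? {P} P? = map′ (λ all x → subst P (element-index x) (all (index x)))
                   (λ all i → all (element i))
                   (Fin.all? (P? ∘ element))

  _≟_ : DecidableEquality A
  x ≟ y = map′ index-injective (cong index) (index x Fin.≟ index y)
    where
    index-injective : index x ≡ index y → x ≡ y
    index-injective eq =
      trans (sym (element-index x)) (trans (cong element eq) (element-index y))

data S₃ : Set where
  ε ρ ρ² : S₃
  τa τb τc : S₃

app : S₃ → K → K
app s  0K = 0K
app ε  k  = k
app ρ  aK = bK
app ρ  bK = cK
app ρ  cK = aK
app ρ² aK = cK
app ρ² bK = aK
app ρ² cK = bK
app τa aK = aK
app τa bK = cK
app τa cK = bK
app τb aK = cK
app τb bK = bK
app τb cK = aK
app τc aK = bK
app τc bK = aK
app τc cK = cK

_⁻¹ : S₃ → S₃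
ε ⁻¹  = ε
ρ ⁻¹  = ρ²
ρ² ⁻¹ = ρ
τa ⁻¹ = τa
τb ⁻¹ = τb
τc ⁻¹ = τc

fromImages : K → K → S₃
fromImages aK bK = ε
fromImages bK cK = ρ
fromImages cK aK = ρ²
fromImages aK cK = τa
fromImages cK bK = τb
fromImages bK aK = τc
fromImages _  _  = ε

-- Composition (s · t applies t first), read off from the images of a, b.
_·_ : S₃ → S₃ → S₃
s · t = fromImages (app s (app t aK)) (app s (app t bK))

isOdd : S₃ → Bool
isOdd ε  = false
isOdd ρ  = false
isOdd ρ² = false
isOdd τa = true
isOdd τb = true
isOdd τc = true

instance
  L-finite : Finite L
  L-finite = record
    { size = 4 ; index = index-L ; element = element-L
    ; element-index = λ { 0L → refl ; 1L → refl ; ωL → refl ; ω̄L → refl } }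
    where
    index-L : L → Fin 4
    index-L 0L  = zero
    index-L 1L  = suc zero
    index-L ωL  = suc (suc zero)
    index-L ω̄L = suc (suc (suc zero))
    element-L : Fin 4 → L
    element-L zero                   = 0L
    element-L (suc zero)             = 1L
    element-L (suc (suc zero))       = ωL
    element-L (suc (suc (suc zero))) = ω̄L

  K-finite : Finite K
  K-finite = record
    { size = 4 ; index = index-K ; element = element-K
    ; element-index = λ { 0K → refl ; aK → refl ; bK → refl ; cK → refl } }
    where
    index-K : K → Fin 4
    index-K 0K = zero
    index-K aK = suc zero
    index-K bK = suc (suc zero)
    index-K cK = suc (suc (suc zero))
    element-K : Fin 4 → K
    element-K zero                   = 0K
    element-K (suc zero)             = aK
    element-K (suc (suc zero))       = bK
    element-K (suc (suc (suc zero))) = cK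

  Bool-finite : Finite Bool
  Bool-finite = record
    { size = 2 ; index = index-B ; element = element-B
    ; element-index = λ { false → refl ; true → refl } }
    where
    index-B : Bool → Fin 2
    index-B false = zero
    index-B true  = suc zero
    element-B : Fin 2 → Bool
    element-B zero       = false
    element-B (suc zero) = true

  Fin-finite : ∀ {n} → Finite (Fin n)
  Fin-finite {n} = record
    { size = n ; index = λ i → i ; element = λ i → i ; element-index = λ _ → refl }

  S₃-finite : Finite S₃
  S₃-finite = record
    { size = 6 ; index = index-S ; element = element-S
    ; element-index = λ { ε → refl ; ρ → refl ; ρ² → refl ; τa → refl ; τb → refl ; τc → refl } }
    where
    index-S : S₃ → Fin 6
    index-S ε  = zero
    index-S ρ  = suc zero
    index-S ρ² = suc (suc zero)
    index-S τa = suc (suc (suc zero))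
    index-S τb = suc (suc (suc (suc zero)))
    index-S τc = suc (suc (suc (suc (suc zero))))
    element-S : Fin 6 → S₃
    element-S zero                               = ε
    element-S (suc zero)                         = ρ
    element-S (suc (suc zero))                   = ρ²
    element-S (suc (suc (suc zero)))             = τa
    element-S (suc (suc (suc (suc zero))))       = τb
    element-S (suc (suc (suc (suc (suc zero))))) = τc

-- S₃ and the local factor Permutation′ 3 of H act on K in the same way.
-- K ∖ {0} is identified with Fin 3 as in the definition of permABC.

decK : Fin 3 → K
decK zero             = aK
decK (suc zero)       = bK
decK (suc (suc zero)) = cK

encK : K → Fin 3
encK 0K = zero
encK aK = zero
encK bK = suc zero
encK cK = suc (suc zero)

permABC-decK : ∀ π i → permABC π (decK i) ≡ decK (π ⟨$⟩ʳ i)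
permABC-decK π zero with π ⟨$⟩ʳ zero
... | zero             = refl
... | suc zero         = refl
... | suc (suc zero)   = refl
permABC-decK π (suc zero) with π ⟨$⟩ʳ suc zero
... | zero             = refl
... | suc zero         = refl
... | suc (suc zero)   = refl
permABC-decK π (suc (suc zero)) with π ⟨$⟩ʳ suc (suc zero)
... | zero             = refl
... | suc zero         = refl
... | suc (suc zero)   = refl

realize : S₃ → Permutation′ 3
realize s = permutation (encK ∘ app s ∘ decK) (encK ∘ app (s ⁻¹) ∘ decK)
                        (inverseˡ-law s) (inverseʳ-law s)
  where
  inverseˡ-law : ∀ s i → encK (app s (decK (encK (app (s ⁻¹) (decK i))))) ≡ i
  inverseˡ-law = from-yes (∀? λ s → ∀? λ i →
    encK (app s (decK (encK (app (s ⁻¹) (decK i))))) ≟ i)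
  inverseʳ-law : ∀ s i → encK (app (s ⁻¹) (decK (encK (app s (decK i))))) ≡ i
  inverseʳ-law = from-yes (∀? λ s → ∀? λ i →
    encK (app (s ⁻¹) (decK (encK (app s (decK i))))) ≟ i)

realize-app : ∀ s k → permABC (realize s) k ≡ app s k
realize-app = from-yes (∀? λ s → ∀? λ k → permABC (realize s) k ≟ app s k)

classify : Permutation′ 3 → S₃
classify π = fromImages (decK (π ⟨$⟩ʳ zero)) (decK (π ⟨$⟩ʳ suc zero))

fromImages-correct : ∀ i j k → i ≢ j → i ≢ k → j ≢ k →
  (app (fromImages (decK i) (decK j)) aK ≡ decK i) ×
  (app (fromImages (decK i) (decK j)) bK ≡ decK j) ×
  (app (fromImages (decK i) (decK j)) cK ≡ decK k)
fromImages-correct = from-yes (∀? λ i → ∀? λ j → ∀? λ k →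
  ¬? (i ≟ j) →-dec ¬? (i ≟ k) →-dec ¬? (j ≟ k) →-dec
    ((app (fromImages (decK i) (decK j)) aK ≟ decK i) ×-dec
     (app (fromImages (decK i) (decK j)) bK ≟ decK j) ×-dec
     (app (fromImages (decK i) (decK j)) cK ≟ decK k)))

-- The images of a, b, c under π are distinct, so classify π is correct.
classify-app : ∀ π k → permABC π k ≡ app (classify π) k
classify-app π = pointwise
  where
  distinct : ∀ {i j} → i ≢ j → π ⟨$⟩ʳ i ≢ π ⟨$⟩ʳ j
  distinct i≢j eq = i≢j (trans (sym (inverseˡ π)) (trans (cong (π ⟨$⟩ˡ_) eq) (inverseˡ π)))
  images : (app (classify π) aK ≡ decK (π ⟨$⟩ʳ zero)) ×
           (app (classify π) bK ≡ decK (π ⟨$⟩ʳ suc zero)) ×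
           (app (classify π) cK ≡ decK (π ⟨$⟩ʳ suc (suc zero)))
  images = fromImages-correct (π ⟨$⟩ʳ zero) (π ⟨$⟩ʳ suc zero) (π ⟨$⟩ʳ suc (suc zero))
                              (distinct λ ()) (distinct λ ()) (distinct λ ())
  pointwise : ∀ k → permABC π k ≡ app (classify π) k
  pointwise 0K = refl
  pointwise aK = trans (permABC-decK π zero) (sym (proj₁ images))
  pointwise bK = trans (permABC-decK π (suc zero)) (sym (proj₁ (proj₂ images)))
  pointwise cK = trans (permABC-decK π (suc (suc zero))) (sym (proj₂ (proj₂ images)))

-- The coordinate isomorphisms ψ m : L → K.

-- The rotation of {a, b, c} taking a to m (the identity for m = 0).
rot : K → S₃
rot 0K = ε
rot aK = ε
rot bK = ρ
rot cK = ρ²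

ψ : K → L → K
ψ m l = app (rot m) (φ l)

φ⁻¹ : K → L
φ⁻¹ 0K = 0L
φ⁻¹ aK = 1L
φ⁻¹ bK = ωL
φ⁻¹ cK = ω̄L

ψ⁻¹ : K → K → L
ψ⁻¹ m k = φ⁻¹ (app (rot m ⁻¹) k)

-- The interchange of ω and ω̄ seen through φ.
flipS : Bool → S₃
flipS false = ε
flipS true  = τa

-- The element of S₃ turning ψ m₁ into ψ m₂ ∘ swapω b.
bridge : K → K → Bool → S₃
bridge m₁ m₂ b = rot m₂ · (flipS b · (rot m₁ ⁻¹))

φ⁻¹-φ : ∀ l → φ⁻¹ (φ l) ≡ l
φ⁻¹-φ = from-yes (∀? λ l → φ⁻¹ (φ l) ≟ l)

φ-φ⁻¹ : ∀ k → φ (φ⁻¹ k) ≡ k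
φ-φ⁻¹ = from-yes (∀? λ k → φ (φ⁻¹ k) ≟ k)

swapω-involutive : ∀ b l → swapω b (swapω b l) ≡ l
swapω-involutive = from-yes (∀? λ b → ∀? λ l → swapω b (swapω b l) ≟ l)

swapω-one : ∀ b → swapω b 1L ≡ 1L
swapω-one = from-yes (∀? λ b → swapω b 1L ≟ 1L)

ψ-hom : ∀ m x y → ψ m (x +L y) ≡ ψ m x +K ψ m y
ψ-hom = from-yes (∀? λ m → ∀? λ x → ∀? λ y → ψ m (x +L y) ≟ (ψ m x +K ψ m y))

ψ-ψ⁻¹ : ∀ m k → ψ m (ψ⁻¹ m k) ≡ k
ψ-ψ⁻¹ = from-yes (∀? λ m → ∀? λ k → ψ m (ψ⁻¹ m k) ≟ k)

ψ-one : ∀ m → m ≢ 0K → ψ m 1L ≡ m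
ψ-one = from-yes (∀? λ m → ¬? (m ≟ 0K) →-dec (ψ m 1L ≟ m))

ψ-standard : ∀ l → ψ aK l ≡ φ l
ψ-standard = from-yes (∀? λ l → ψ aK l ≟ φ l)

app-nonzero : ∀ s m → m ≢ 0K → app s m ≢ 0K
app-nonzero = from-yes (∀? λ s → ∀? λ m → ¬? (m ≟ 0K) →-dec ¬? (app s m ≟ 0K))

ψ-equivariant : ∀ s m → m ≢ 0K → ∀ l → ψ (app s m) (swapω (isOdd s) l) ≡ app s (ψ m l)
ψ-equivariant = from-yes (∀? λ s → ∀? λ m → ¬? (m ≟ 0K) →-dec ∀? λ l →
  ψ (app s m) (swapω (isOdd s) l) ≟ app s (ψ m l))

ψ-bridge : ∀ m₁ m₂ b l → app (bridge m₁ m₂ b) (ψ m₁ l) ≡ ψ m₂ (swapω b l)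
ψ-bridge = from-yes (∀? λ m₁ → ∀? λ m₂ → ∀? λ b → ∀? λ l →
  app (bridge m₁ m₂ b) (ψ m₁ l) ≟ ψ m₂ (swapω b l))

permABC-nonzero : ∀ π m → m ≢ 0K → permABC π m ≢ 0K
permABC-nonzero π m m≢0 = subst (_≢ 0K) (sym (classify-app π m)) (app-nonzero (classify π) m m≢0)

permABC-equivariant : ∀ π m → m ≢ 0K → ∀ l →
  ψ (permABC π m) (swapω (isOdd (classify π)) l) ≡ permABC π (ψ m l)
permABC-equivariant π m m≢0 l = begin
  ψ (permABC π m) (swapω (isOdd s) l) ≡⟨ cong (λ m′ → ψ m′ (swapω (isOdd s) l)) (classify-app π m) ⟩
  ψ (app s m) (swapω (isOdd s) l)     ≡⟨ ψ-equivariant s m m≢0 l ⟩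
  app s (ψ m l)                       ≡⟨ sym (classify-app π (ψ m l)) ⟩
  permABC π (ψ m l)                   ∎
  where
  open ≡-Reasoning
  s : S₃
  s = classify π

vec-ext : ∀ {A : Set} {n} {u v : Vec A n} → (∀ i → lookup u i ≡ lookup v i) → u ≡ v
vec-ext u≗v = Pointwise-≡⇒≡ (ext u≗v)

map-inverse : ∀ {A B : Set} {n} {f : A → B} {g : B → A} →
  (∀ a → g (f a) ≡ a) → (x : Vec A n) → map g (map f x) ≡ x
map-inverse {f = f} {g} g∘f x = vec-ext λ i → begin
  lookup (map g (map f x)) i ≡⟨ lookup-map i g (map f x) ⟩
  g (lookup (map f x) i)     ≡⟨ cong g (lookup-map i f x) ⟩
  g (f (lookup x i))         ≡⟨ g∘f (lookup x i) ⟩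
  lookup x i                 ∎
  where open ≡-Reasoning

Ψ : ∀ {n} → Vec K n → Vec L n → Vec K n
Ψ = zipWith ψ

lookup-Ψ : ∀ {n} (M : Vec K n) x i → lookup (Ψ M x) i ≡ ψ (lookup M i) (lookup x i)
lookup-Ψ M x i = lookup-zipWith ψ i M x

Ψ-zero : ∀ {n} (M : Vec K n) → Ψ M (replicate n 0L) ≡ replicate n 0K
Ψ-zero M = vec-ext λ i → begin
  lookup (Ψ M (replicate _ 0L)) i         ≡⟨ lookup-Ψ M _ i ⟩
  ψ (lookup M i) (lookup (replicate _ 0L) i) ≡⟨ cong (ψ (lookup M i)) (lookup-replicate i 0L) ⟩
  0K                                      ≡⟨ sym (lookup-replicate i 0K) ⟩
  lookup (replicate _ 0K) i               ∎
  where open ≡-Reasoning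

Ψ-hom : ∀ {n} (M : Vec K n) x y → Ψ M (zipWith _+L_ x y) ≡ zipWith _+K_ (Ψ M x) (Ψ M y)
Ψ-hom M x y = vec-ext λ i → begin
  lookup (Ψ M (zipWith _+L_ x y)) i                  ≡⟨ lookup-Ψ M _ i ⟩
  ψ (lookup M i) (lookup (zipWith _+L_ x y) i)       ≡⟨ cong (ψ (lookup M i)) (lookup-zipWith _+L_ i x y) ⟩
  ψ (lookup M i) (lookup x i +L lookup y i)          ≡⟨ ψ-hom (lookup M i) (lookup x i) (lookup y i) ⟩
  ψ (lookup M i) (lookup x i) +K ψ (lookup M i) (lookup y i)
    ≡⟨ sym (cong₂ _+K_ (lookup-Ψ M x i) (lookup-Ψ M y i)) ⟩
  lookup (Ψ M x) i +K lookup (Ψ M y) i               ≡⟨ sym (lookup-zipWith _+K_ i (Ψ M x) (Ψ M y)) ⟩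
  lookup (zipWith _+K_ (Ψ M x) (Ψ M y)) i            ∎
  where open ≡-Reasoning

Ψ-onto : ∀ {n} (M : Vec K n) y → Ψ M (zipWith ψ⁻¹ M y) ≡ y
Ψ-onto M y = vec-ext λ i → begin
  lookup (Ψ M (zipWith ψ⁻¹ M y)) i              ≡⟨ lookup-Ψ M _ i ⟩
  ψ (lookup M i) (lookup (zipWith ψ⁻¹ M y) i)   ≡⟨ cong (ψ (lookup M i)) (lookup-zipWith ψ⁻¹ i M y) ⟩
  ψ (lookup M i) (ψ⁻¹ (lookup M i) (lookup y i)) ≡⟨ ψ-ψ⁻¹ (lookup M i) (lookup y i) ⟩
  lookup y i                                    ∎
  where open ≡-Reasoning

Ψ-ones : ∀ {n} (M : Vec K n) → All (_≢ 0K) M → Ψ M (replicate n 1L) ≡ M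
Ψ-ones M M≢0 = vec-ext λ i → begin
  lookup (Ψ M (replicate _ 1L)) i             ≡⟨ lookup-Ψ M _ i ⟩
  ψ (lookup M i) (lookup (replicate _ 1L) i)  ≡⟨ cong (ψ (lookup M i)) (lookup-replicate i 1L) ⟩
  ψ (lookup M i) 1L                           ≡⟨ ψ-one (lookup M i) (lookup⁺ M≢0 i) ⟩
  lookup M i                                  ∎
  where open ≡-Reasoning

standard : ∀ {n} → Vec K n
standard {n} = replicate n aK

Ψ-standard : ∀ {n} (x : Vec L n) → Ψ standard x ≡ map φ x
Ψ-standard x = vec-ext λ i → begin
  lookup (Ψ standard x) i                      ≡⟨ lookup-Ψ standard x i ⟩
  ψ (lookup (replicate _ aK) i) (lookup x i)   ≡⟨ cong (λ m → ψ m (lookup x i)) (lookup-replicate i aK) ⟩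
  ψ aK (lookup x i)                            ≡⟨ ψ-standard (lookup x i) ⟩
  φ (lookup x i)                               ≡⟨ sym (lookup-map i φ x) ⟩
  lookup (map φ x) i                           ∎
  where open ≡-Reasoning

-- φ is a bijection, so φ(C) is the preimage of C under φ⁻¹.
φ-image-iff : ∀ {n} (C : Pred (Vec L n) 0ℓ) y → φ-image C y ⇔ C (map φ⁻¹ y)
φ-image-iff C y = mk⇔ to from
  where
  to : φ-image C y → C (map φ⁻¹ y)
  to (x , Cx , refl) = subst C (sym (map-inverse φ⁻¹-φ x)) Cx
  from : C (map φ⁻¹ y) → φ-image C y
  from C-y = map φ⁻¹ y , C-y , map-inverse φ-φ⁻¹ y

lookup-actG : ∀ {n} (σ : Permutation′ n) t x j →
  lookup (actG (mkG σ t) x) j ≡ swapω (t (σ ⟨$⟩ˡ j)) (lookup x (σ ⟨$⟩ˡ j))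
lookup-actG σ t x = lookup∘tabulate λ j → swapω (t (σ ⟨$⟩ˡ j)) (lookup x (σ ⟨$⟩ˡ j))

lookup-actH : ∀ {n} (σ : Permutation′ n) τ y j →
  lookup (actH (mkH σ τ) y) j ≡ permABC (τ (σ ⟨$⟩ˡ j)) (lookup y (σ ⟨$⟩ˡ j))
lookup-actH σ τ y = lookup∘tabulate λ j → permABC (τ (σ ⟨$⟩ˡ j)) (lookup y (σ ⟨$⟩ˡ j))

idG : ∀ {n} → GElt n
idG = mkG idₚ (λ _ → false)

actG-id : ∀ {n} (x : Vec L n) → actG idG x ≡ x
actG-id x = vec-ext (lookup-actG idₚ (λ _ → false) x)

actG-ones : ∀ {n} (g : GElt n) → actG g (replicate n 1L) ≡ replicate n 1L
actG-ones (mkG σ t) = vec-ext pointwise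
  where
  open ≡-Reasoning
  pointwise : ∀ j → lookup (actG (mkG σ t) (replicate _ 1L)) j ≡ lookup (replicate _ 1L) j
  pointwise j = begin
    lookup (actG (mkG σ t) (replicate _ 1L)) j               ≡⟨ lookup-actG σ t (replicate _ 1L) j ⟩
    swapω (t (σ ⟨$⟩ˡ j)) (lookup (replicate _ 1L) (σ ⟨$⟩ˡ j)) ≡⟨ cong (swapω (t (σ ⟨$⟩ˡ j))) (lookup-replicate (σ ⟨$⟩ˡ j) 1L) ⟩
    swapω (t (σ ⟨$⟩ˡ j)) 1L                                  ≡⟨ swapω-one (t (σ ⟨$⟩ˡ j)) ⟩
    1L                                                       ≡⟨ sym (lookup-replicate j 1L) ⟩
    lookup (replicate _ 1L) j                                ∎

_⁻¹G : ∀ {n} → GElt n → GElt n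
mkG σ t ⁻¹G = mkG (flip σ) (λ k → t (σ ⟨$⟩ˡ k))

actG-inverse : ∀ {n} (g : GElt n) x → actG g (actG (g ⁻¹G) x) ≡ x
actG-inverse (mkG σ t) x = vec-ext pointwise
  where
  open ≡-Reasoning
  pointwise : ∀ j → lookup (actG (mkG σ t) (actG (mkG σ t ⁻¹G) x)) j ≡ lookup x j
  pointwise j = begin
    lookup (actG (mkG σ t) (actG (mkG σ t ⁻¹G) x)) j
      ≡⟨ lookup-actG σ t (actG (mkG σ t ⁻¹G) x) j ⟩
    swapω (t i) (lookup (actG (mkG σ t ⁻¹G) x) i)
      ≡⟨ cong (swapω (t i)) (lookup-actG (flip σ) (λ k → t (σ ⟨$⟩ˡ k)) x i) ⟩
    swapω (t i) (swapω (t (σ ⟨$⟩ˡ (σ ⟨$⟩ʳ i))) (lookup x (σ ⟨$⟩ʳ i)))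
      ≡⟨ cong (λ k → swapω (t i) (swapω (t (σ ⟨$⟩ˡ k)) (lookup x k))) (inverseʳ σ) ⟩
    swapω (t i) (swapω (t i) (lookup x j))
      ≡⟨ swapω-involutive (t i) (lookup x j) ⟩
    lookup x j ∎
    where
    i : Fin _
    i = σ ⟨$⟩ˡ j

≈G-sym : ∀ {n} {C₁ C₂ : Pred (Vec L n) 0ℓ} → C₁ ≈G C₂ → C₂ ≈G C₁
≈G-sym {C₁ = C₁} {C₂} (g , C₁≈C₂) = g ⁻¹G , λ y → begin
  C₂ y                      ≡⟨ cong C₂ (actG-inverse g y) ⟨
  C₂ (actG g (actG (g ⁻¹G) y)) ≈⟨ C₁≈C₂ (actG (g ⁻¹G) y) ⟨
  C₁ (actG (g ⁻¹G) y)       ∎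
  where open ⇔-Reasoning

-- Transport between G and H along Ψ.

Ψ-intertwines : ∀ {n} (σ : Permutation′ n) t τ (M₁ M₂ : Vec K n) →
  (∀ j l → ψ (lookup M₂ j) (swapω (t (σ ⟨$⟩ˡ j)) l)
         ≡ permABC (τ (σ ⟨$⟩ˡ j)) (ψ (lookup M₁ (σ ⟨$⟩ˡ j)) l)) →
  ∀ x → Ψ M₂ (actG (mkG σ t) x) ≡ actH (mkH σ τ) (Ψ M₁ x)
Ψ-intertwines σ t τ M₁ M₂ local x = vec-ext pointwise
  where
  open ≡-Reasoning
  pointwise : ∀ j → lookup (Ψ M₂ (actG (mkG σ t) x)) j ≡ lookup (actH (mkH σ τ) (Ψ M₁ x)) j
  pointwise j = begin
    lookup (Ψ M₂ (actG (mkG σ t) x)) j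
      ≡⟨ lookup-Ψ M₂ (actG (mkG σ t) x) j ⟩
    ψ (lookup M₂ j) (lookup (actG (mkG σ t) x) j)
      ≡⟨ cong (ψ (lookup M₂ j)) (lookup-actG σ t x j) ⟩
    ψ (lookup M₂ j) (swapω (t i) (lookup x i))
      ≡⟨ local j (lookup x i) ⟩
    permABC (τ i) (ψ (lookup M₁ i) (lookup x i))
      ≡⟨ cong (permABC (τ i)) (lookup-Ψ M₁ x i) ⟨
    permABC (τ i) (lookup (Ψ M₁ x) i)
      ≡⟨ lookup-actH σ τ (Ψ M₁ x) j ⟨
    lookup (actH (mkH σ τ) (Ψ M₁ x)) j ∎
    where
    i : Fin _
    i = σ ⟨$⟩ˡ j

H-to-G : ∀ {n} (h : HElt n) (M : Vec K n) → All (_≢ 0K) M →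
  Σ (GElt n) λ g → ∀ x → Ψ (actH h M) (actG g x) ≡ actH h (Ψ M x)
H-to-G (mkH σ τ) M M≢0 =
  mkG σ (isOdd ∘ classify ∘ τ) , Ψ-intertwines σ (isOdd ∘ classify ∘ τ) τ M (actH (mkH σ τ) M) local
  where
  open ≡-Reasoning
  local : ∀ j l → ψ (lookup (actH (mkH σ τ) M) j) (swapω (isOdd (classify (τ (σ ⟨$⟩ˡ j)))) l)
                ≡ permABC (τ (σ ⟨$⟩ˡ j)) (ψ (lookup M (σ ⟨$⟩ˡ j)) l)
  local j l = begin
    ψ (lookup (actH (mkH σ τ) M) j) (swapω (isOdd (classify (τ i))) l)
      ≡⟨ cong (λ m → ψ m (swapω (isOdd (classify (τ i))) l)) (lookup-actH σ τ M j) ⟩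
    ψ (permABC (τ i) (lookup M i)) (swapω (isOdd (classify (τ i))) l)
      ≡⟨ permABC-equivariant (τ i) (lookup M i) (lookup⁺ M≢0 i) l ⟩
    permABC (τ i) (ψ (lookup M i) l) ∎
    where
    i : Fin _
    i = σ ⟨$⟩ˡ j

G-to-H : ∀ {n} (g : GElt n) (M₁ M₂ : Vec K n) →
  Σ (HElt n) λ h → ∀ x → Ψ M₂ (actG g x) ≡ actH h (Ψ M₁ x)
G-to-H (mkG σ t) M₁ M₂ = mkH σ τ , Ψ-intertwines σ t τ M₁ M₂ local
  where
  open ≡-Reasoning
  τ : Fin _ → Permutation′ 3
  τ i = realize (bridge (lookup M₁ i) (lookup M₂ (σ ⟨$⟩ʳ i)) (t i))
  local : ∀ j l → ψ (lookup M₂ j) (swapω (t (σ ⟨$⟩ˡ j)) l)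
                ≡ permABC (τ (σ ⟨$⟩ˡ j)) (ψ (lookup M₁ (σ ⟨$⟩ˡ j)) l)
  local j l = begin
    ψ (lookup M₂ j) (swapω (t i) l)
      ≡⟨ cong (λ k → ψ (lookup M₂ k) (swapω (t i) l)) (inverseʳ σ) ⟨
    ψ (lookup M₂ (σ ⟨$⟩ʳ i)) (swapω (t i) l)
      ≡⟨ ψ-bridge (lookup M₁ i) (lookup M₂ (σ ⟨$⟩ʳ i)) (t i) l ⟨
    app (bridge (lookup M₁ i) (lookup M₂ (σ ⟨$⟩ʳ i)) (t i)) (ψ (lookup M₁ i) l)
      ≡⟨ realize-app _ (ψ (lookup M₁ i) l) ⟨
    permABC (τ i) (ψ (lookup M₁ i) l) ∎
    where
    i : Fin _
    i = σ ⟨$⟩ˡ j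

standard-marked : ∀ {n} → All (_≢ 0K) (standard {n})
standard-marked = lookup⁻ λ i → subst (_≢ 0K) (sym (lookup-replicate i aK)) λ ()

actH-marking : ∀ {n} (h : HElt n) M → All (_≢ 0K) M → All (_≢ 0K) (actH h M)
actH-marking (mkH σ τ) M M≢0 = lookup⁻ λ j →
  subst (_≢ 0K) (sym (lookup-actH σ τ M j))
        (permABC-nonzero (τ (σ ⟨$⟩ˡ j)) (lookup M (σ ⟨$⟩ˡ j)) (lookup⁺ M≢0 (σ ⟨$⟩ˡ j)))

module _ {n : ℕ} (D : Pred (Vec K n) 0ℓ) where

  preimage : Vec K n → Pred (Vec L n) 0ℓ
  preimage M x = D (Ψ M x)

  preimage-isLCode : IsKleinianCode D → ∀ M → IsLCode (preimage M)
  preimage-isLCode (D-zero , D-closed) M =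
    subst D (sym (Ψ-zero M)) D-zero ,
    λ x y Dx Dy → subst D (sym (Ψ-hom M x y)) (D-closed (Ψ M x) (Ψ M y) Dx Dy)

  image-equiv : ∀ M → φ-image (preimage M) ≈H D
  image-equiv M = h , equiv
    where
    h : HElt n
    h = proj₁ (G-to-H idG standard M)
    Ψ-φ⁻¹ : ∀ y → Ψ M (map φ⁻¹ y) ≡ actH h y
    Ψ-φ⁻¹ y = begin
      Ψ M (map φ⁻¹ y)                       ≡⟨ cong (Ψ M) (actG-id (map φ⁻¹ y)) ⟨
      Ψ M (actG idG (map φ⁻¹ y))            ≡⟨ proj₂ (G-to-H idG standard M) (map φ⁻¹ y) ⟩
      actH h (Ψ standard (map φ⁻¹ y))       ≡⟨ cong (actH h) (Ψ-standard (map φ⁻¹ y)) ⟩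
      actH h (map φ (map φ⁻¹ y))            ≡⟨ cong (actH h) (map-inverse φ-φ⁻¹ y) ⟩
      actH h y                              ∎
      where open ≡-Reasoning
    equiv : ∀ y → φ-image (preimage M) y ⇔ D (actH h y)
    equiv y = begin
      φ-image (preimage M) y    ≈⟨ φ-image-iff (preimage M) y ⟩
      D (Ψ M (map φ⁻¹ y))       ≡⟨ cong D (Ψ-φ⁻¹ y) ⟩
      D (actH h y)              ∎
      where open ⇔-Reasoning

  marking-equiv⇒ : ∀ M₁ M₂ → MarkingEquiv D M₁ M₂ → preimage (proj₁ M₁) ≈G preimage (proj₁ M₂)
  marking-equiv⇒ (M₁ , M₁≢0) (_ , _) (h , h-aut , refl) = g , λ x → begin
    D (Ψ M₁ x)                     ≈⟨ h-aut (Ψ M₁ x) ⟩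
    D (actH h (Ψ M₁ x))            ≡⟨ cong D (g-transports x) ⟨
    D (Ψ (actH h M₁) (actG g x))   ∎
    where
    open ⇔-Reasoning
    g : GElt n
    g = proj₁ (H-to-G h M₁ M₁≢0)
    g-transports : ∀ x → Ψ (actH h M₁) (actG g x) ≡ actH h (Ψ M₁ x)
    g-transports = proj₂ (H-to-G h M₁ M₁≢0)

  -- Markings with equivalent codes are equivalent: the h ∈ H transported
  -- from g preserves D (Ψ M₁ is onto) and moves M₁ = Ψ M₁ (1,…,1) to M₂.
  marking-equiv⇐ : ∀ M₁ M₂ → preimage (proj₁ M₁) ≈G preimage (proj₁ M₂) → MarkingEquiv D M₁ M₂
  marking-equiv⇐ (M₁ , M₁≢0) (M₂ , M₂≢0) (g , g-equiv) = h , h-aut , h-moves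
    where
    h : HElt n
    h = proj₁ (G-to-H g M₁ M₂)
    h-transports : ∀ x → Ψ M₂ (actG g x) ≡ actH h (Ψ M₁ x)
    h-transports = proj₂ (G-to-H g M₁ M₂)
    h-aut : InAut D h
    h-aut y = begin
      D y                        ≡⟨ cong D (Ψ-onto M₁ y) ⟨
      D (Ψ M₁ x)                 ≈⟨ g-equiv x ⟩
      D (Ψ M₂ (actG g x))        ≡⟨ cong D (h-transports x) ⟩
      D (actH h (Ψ M₁ x))        ≡⟨ cong (D ∘ actH h) (Ψ-onto M₁ y) ⟩
      D (actH h y)               ∎
      where
      open ⇔-Reasoning
      x : Vec L n
      x = zipWith ψ⁻¹ M₁ y
    h-moves : actH h M₁ ≡ M₂
    h-moves = begin
      actH h M₁                          ≡⟨ cong (actH h) (Ψ-ones M₁ M₁≢0) ⟨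
      actH h (Ψ M₁ (replicate n 1L))     ≡⟨ h-transports (replicate n 1L) ⟨
      Ψ M₂ (actG g (replicate n 1L))     ≡⟨ cong (Ψ M₂) (actG-ones g) ⟩
      Ψ M₂ (replicate n 1L)              ≡⟨ Ψ-ones M₂ M₂≢0 ⟩
      M₂                                 ∎
      where open ≡-Reasoning

  -- Every C with φ(C) ≈ D is equivalent to C_M for the marking M = h (a, …, a).
  every-code-marked : ∀ (C : Pred (Vec L n) 0ℓ) → φ-image C ≈H D →
    ∃ λ (M : Marking n) → preimage (proj₁ M) ≈G C
  every-code-marked C (h , h-equiv) =
    (actH h standard , actH-marking h standard standard-marked) , ≈G-sym (g , C≈C-M)
    where
    g : GElt n
    g = proj₁ (H-to-G h standard standard-marked)
    g-transports : ∀ x → Ψ (actH h standard) (actG g x) ≡ actH h (Ψ standard x)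
    g-transports = proj₂ (H-to-G h standard standard-marked)
    C≈C-M : ∀ x → C x ⇔ preimage (actH h standard) (actG g x)
    C≈C-M x = begin
      C x                                    ≡⟨ cong C (map-inverse φ⁻¹-φ x) ⟨
      C (map φ⁻¹ (map φ x))                  ≈⟨ φ-image-iff C (map φ x) ⟨
      φ-image C (map φ x)                    ≈⟨ h-equiv (map φ x) ⟩
      D (actH h (map φ x))                   ≡⟨ cong (D ∘ actH h) (Ψ-standard x) ⟨
      D (actH h (Ψ standard x))              ≡⟨ cong D (g-transports x) ⟨
      D (Ψ (actH h standard) (actG g x))     ∎
      where open ⇔-Reasoning

lemma3p9 : (n : ℕ) (D : Pred (Vec K n) 0ℓ) → IsKleinianCode D →
    Σ (Marking n → LCode n) λ f →
      (∀ M → φ-image (code (f M)) ≈H D) ×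
      (∀ M₁ M₂ → MarkingEquiv D M₁ M₂ ⇔ (code (f M₁) ≈G code (f M₂))) ×
      (∀ (C : LCode n) → φ-image (code C) ≈H D → ∃ λ M → code (f M) ≈G code C)
lemma3p9 n D D-code =
  markedCode ,
  (λ M → image-equiv D (proj₁ M)) ,
  (λ M₁ M₂ → mk⇔ (marking-equiv⇒ D M₁ M₂) (marking-equiv⇐ D M₁ M₂)) ,
  (λ C → every-code-marked D (code C))
  where
  markedCode : Marking n → LCode n
  markedCode (M , _) = record { code = preimage D M ; isCode = preimage-isLCode D D-code M }
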